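{- Let $\mathcal{M}$ be an $\mathcal{L}$-structure. The following are equivalent: (1) $\mathcal{M}$ is elementarily indivisible; (2) $\widehat{\mathcal{M}}$ is indivisible; (3) $\widehat{\mathcal{M}}$ is elementarily indivisible; (4) every reduct of $\mathcal{M}$ is indivisible; (5) every reduct of $\mathcal{M}$ is elementarily indivisible.
   Context: $\mathcal{M}$ is indivisible if for every coloring of its universe in two colors there is a monochromatic substructure $\mathcal{M}'\subseteq\mathcal{M}$ with $\mathcal{M}'\cong\mathcal{M}$; elementarily indivisible if moreover $\mathcal{M}'$ can be chosen with $\mathcal{M}'\preceq\mathcal{M}$. A reduct of $\mathcal{M}$ is a structure $\mathcal{M}'$ (in some language) with the same universe as $\mathcal{M}$ such that every $\emptyset$-definable relation of $\mathcal{M}'$ is $\emptyset$-definable in $\mathcal{M}$. The Morleyzation $\widehat{\mathcal{M}}$ is the structure with the same universe in the language $\widehat{\mathcal{L}}$ obtained by adding to $\mathcal{L}$, for each $\mathcal{L}$-formula $\phi(v_1,\dots,v_n)$, a new $n$-ary relation symbol $R_\phi$, interpreted as $\{\bar a\in M^n : \mathcal{M}\models\phi(\bar a)\}$, with symbols of $\mathcal{L}$ interpreted as in $\mathcal{M}$. -}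

module Defs where

open import Data.Nat using (ℕ; suc)
open import Data.Fin using (Fin)
open import Data.Vec using (Vec; []; _∷_; lookup; map)
open import Data.Bool using (Bool)
open import Data.Product using (Σ; _×_; _,_; proj₁)
open import Data.Sum using (_⊎_; inj₁; inj₂)
open import Data.Unit using (⊤)
open import Data.Empty using (⊥)
open import Function.Bundles using (_⇔_)
open import Relation.Binary.PropositionalEquality using (_≡_)

record Language : Set₁ where
  field
    Func     : Set
    funArity : Func → ℕ
    Rel      : Set
    relArity : Rel → ℕ
open Language public

record Structure (L : Language) (A : Set) : Set₁ where
  field
    fun : (f : Func L) → Vec A (funArity L f) → A
    rel : (R : Rel L) → Vec A (relArity L R) → Set
open Structure public

-- Terms and formulas with at most n free variables (de Bruijn: variable i is
-- the i-th entry of the assignment; quantifiers bind index 0).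
data Term (L : Language) (n : ℕ) : Set where
  var : Fin n → Term L n
  app : (f : Func L) → Vec (Term L n) (funArity L f) → Term L n

data Formula (L : Language) : ℕ → Set where
  ⊤ᶠ ⊥ᶠ : ∀ {n} → Formula L n
  _≐_   : ∀ {n} → Term L n → Term L n → Formula L n
  relᶠ  : ∀ {n} (R : Rel L) → Vec (Term L n) (relArity L R) → Formula L n
  ¬ᶠ_   : ∀ {n} → Formula L n → Formula L n
  _∧ᶠ_ _∨ᶠ_ _⇒ᶠ_ : ∀ {n} → Formula L n → Formula L n → Formula L n
  ∃ᶠ ∀ᶠ : ∀ {n} → Formula L (suc n) → Formula L n

module _ {L : Language} {A : Set} (M : Structure L A) where
  mutual
    evalT : ∀ {n} → Vec A n → Term L n → A
    evalT ρ (var i)    = lookup ρ i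
    evalT ρ (app f ts) = fun M f (evalTs ρ ts)

    evalTs : ∀ {n k} → Vec A n → Vec (Term L n) k → Vec A k
    evalTs ρ []       = []
    evalTs ρ (t ∷ ts) = evalT ρ t ∷ evalTs ρ ts

  Sat : ∀ {n} → Vec A n → Formula L n → Set
  Sat ρ ⊤ᶠ          = ⊤
  Sat ρ ⊥ᶠ          = ⊥
  Sat ρ (s ≐ t)     = evalT ρ s ≡ evalT ρ t
  Sat ρ (relᶠ R ts) = rel M R (evalTs ρ ts)
  Sat ρ (¬ᶠ φ)      = Sat ρ φ → ⊥
  Sat ρ (φ ∧ᶠ ψ)    = Sat ρ φ × Sat ρ ψ
  Sat ρ (φ ∨ᶠ ψ)    = Sat ρ φ ⊎ Sat ρ ψ
  Sat ρ (φ ⇒ᶠ ψ)    = Sat ρ φ → Sat ρ ψ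
  Sat ρ (∃ᶠ φ)      = Σ A λ a → Sat (a ∷ ρ) φ
  Sat ρ (∀ᶠ φ)      = (a : A) → Sat (a ∷ ρ) φ

  record Substructure : Set₁ where
    field
      P      : A → Set
      P-prop : ∀ x (p q : P x) → p ≡ q
      closed : ∀ (f : Func L) (xs : Vec (Σ A P) (funArity L f)) →
               P (fun M f (map proj₁ xs))
  open Substructure public

  induced : (S : Substructure) → Structure L (Σ A (P S))
  induced S = record
    { fun = λ f xs → fun M f (map proj₁ xs) , closed S f xs
    ; rel = λ R xs → rel M R (map proj₁ xs) }


record Iso {L : Language} {B A : Set} (N : Structure L B) (M : Structure L A) : Set where
  field
    to      : B → A
    from    : A → B
    from-to : ∀ x → from (to x) ≡ x
    to-from : ∀ y → to (from y) ≡ y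
    to-fun  : ∀ (f : Func L) (xs : Vec B (funArity L f)) →
              to (fun N f xs) ≡ fun M f (map to xs)
    to-rel  : ∀ (R : Rel L) (xs : Vec B (relArity L R)) →
              rel N R xs ⇔ rel M R (map to xs)

module _ {L : Language} {A : Set} (M : Structure L A) where
  ElementarySub : Substructure M → Set
  ElementarySub S = ∀ n (φ : Formula L n) (ρ : Vec (Σ A (P S)) n) →
                    Sat (induced M S) ρ φ ⇔ Sat M (map proj₁ ρ) φ

  Monochromatic : Substructure M → (A → Bool) → Set
  Monochromatic S c = Σ Bool λ b → ∀ x → P S x → c x ≡ b

  Indivisible : Set₁
  Indivisible = (c : A → Bool) →
    Σ (Substructure M) λ S → Monochromatic S c × Iso (induced M S) M

  ElemIndivisible : Set₁
  ElemIndivisible = (c : A → Bool) →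
    Σ (Substructure M) λ S →
      Monochromatic S c × Iso (induced M S) M × ElementarySub S

  Definable : ∀ {n} → (Vec A n → Set) → Set
  Definable {n} R = Σ (Formula L n) λ φ → ∀ ā → R ā ⇔ Sat M ā φ

IsReduct : {L L' : Language} {A : Set} → Structure L A → Structure L' A → Set₁
IsReduct {A = A} M N = ∀ n (R : Vec A n → Set) → Definable N R → Definable M R

MorleyLang : Language → Language
MorleyLang L = record
  { Func = Func L ; funArity = funArity L
  ; Rel = Rel L ⊎ Σ ℕ (Formula L)
  ; relArity = λ { (inj₁ R) → relArity L R ; (inj₂ (n , _)) → n } }

Morleyize : {L : Language} {A : Set} → Structure L A → Structure (MorleyLang L) A
Morleyize M = record
  { fun = fun M
  ; rel = λ { (inj₁ R) xs → rel M R xs ; (inj₂ (n , φ)) xs → Sat M xs φ } }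

module Submission where

-- The central notion is an elementary copy of a structure M with universe A:
-- a subset P ⊆ A with a bijection  to : P → A  such that a tuple ρ from P
-- satisfies a formula exactly when  to ρ  does.  This notion mentions only
-- formulas, so an elementary copy of M is one of every reduct of M; and an
-- elementary copy of any N is already an elementary substructure isomorphic
-- to N, because graphs of functions and atomic relations are definable.
-- Elementary substructures isomorphic to M give elementary copies (isomorphisms
-- preserve satisfaction), and so do substructures of the Morleyization M̂
-- isomorphic to M̂ (they preserve every symbol R_φ).  Finally M̂ is a reduct
-- of M, by translating each atom R_φ(t̄) to the substitution instance φ(t̄).

open import Defs
open import Data.Nat using (suc; zero)
open import Data.Fin using (Fin; zero; suc)
open import Data.Vec using (Vec; []; _∷_; lookup; map; tabulate)
open import Data.Vec.Properties using (lookup-map; tabulate∘lookup)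
open import Data.Bool using (Bool)
open import Data.Product using (_×_; Σ; _,_; proj₁; proj₂)
open import Data.Sum using (inj₁; inj₂)
open import Data.Product.Function.NonDependent.Propositional using (_×-⇔_)
open import Data.Product.Function.Dependent.Propositional as Σ-Fun using ()
open import Data.Sum.Function.Propositional using (_⊎-⇔_)
open import Function.Base using (_∘_)
open import Function.Bundles using (_⇔_; mk⇔; Equivalence; _↔_; mk↔ₛ′; Inverse)
open import Function.Properties.Equivalence as ⇔ using ()
open import Function.Properties.Inverse using (↔-refl)
open import Function.Related.TypeIsomorphisms using (→-cong-⇔; ¬-cong-⇔)
open import Relation.Binary.PropositionalEquality

open Equivalence using () renaming (to to forward; from to backward)

module _ {B A : Set} {P : B → Set} {Q : A → Set} (e : B ↔ A) where
  open Inverse e using (to; from; strictlyInverseˡ)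

  ∃-transport : (∀ b → P b ⇔ Q (to b)) → Σ B P ⇔ Σ A Q
  ∃-transport h = Σ-Fun.cong e (λ {b} → h b)

  ∀-transport : (∀ b → P b ⇔ Q (to b)) → ((b : B) → P b) ⇔ ((a : A) → Q a)
  ∀-transport h = mk⇔
    (λ p a → subst Q (strictlyInverseˡ a) (forward (h (from a)) (p (from a))))
    (λ q b → backward (h b) (q (to b)))

module IsoSat {L : Language} {B A : Set} {N : Structure L B} {M : Structure L A}
              (I : Iso N M) where
  open Iso I

  bijection : B ↔ A
  bijection = mk↔ₛ′ to from to-from from-to

  to-injective : ∀ {x y} → to x ≡ to y → x ≡ y
  to-injective {x} {y} eq = begin
    x             ≡⟨ sym (from-to x) ⟩
    from (to x)   ≡⟨ cong from eq ⟩
    from (to y)   ≡⟨ from-to y ⟩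
    y             ∎
    where open ≡-Reasoning

  mutual
    to-evalT : ∀ {n} (ρ : Vec B n) (t : Term L n) → to (evalT N ρ t) ≡ evalT M (map to ρ) t
    to-evalT ρ (var i)    = sym (lookup-map i to ρ)
    to-evalT ρ (app f ts) = trans (to-fun f (evalTs N ρ ts)) (cong (fun M f) (to-evalTs ρ ts))

    to-evalTs : ∀ {n k} (ρ : Vec B n) (ts : Vec (Term L n) k) →
                map to (evalTs N ρ ts) ≡ evalTs M (map to ρ) ts
    to-evalTs ρ []       = refl
    to-evalTs ρ (t ∷ ts) = cong₂ _∷_ (to-evalT ρ t) (to-evalTs ρ ts)

  iso-Sat : ∀ {n} (ρ : Vec B n) φ → Sat N ρ φ ⇔ Sat M (map to ρ) φ
  iso-Sat ρ ⊤ᶠ          = ⇔.refl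
  iso-Sat ρ ⊥ᶠ          = ⇔.refl
  iso-Sat ρ (s ≐ t)     = mk⇔
    (λ eq → trans (sym (to-evalT ρ s)) (trans (cong to eq) (to-evalT ρ t)))
    (λ eq → to-injective (trans (to-evalT ρ s) (trans eq (sym (to-evalT ρ t)))))
  iso-Sat ρ (relᶠ R ts) = ⇔.trans (to-rel R (evalTs N ρ ts))
    (mk⇔ (subst (rel M R) (to-evalTs ρ ts)) (subst (rel M R) (sym (to-evalTs ρ ts))))
  iso-Sat ρ (¬ᶠ φ)      = ¬-cong-⇔ (iso-Sat ρ φ)
  iso-Sat ρ (φ ∧ᶠ ψ)    = iso-Sat ρ φ ×-⇔ iso-Sat ρ ψ
  iso-Sat ρ (φ ∨ᶠ ψ)    = iso-Sat ρ φ ⊎-⇔ iso-Sat ρ ψ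
  iso-Sat ρ (φ ⇒ᶠ ψ)    = →-cong-⇔ (iso-Sat ρ φ) (iso-Sat ρ ψ)
  iso-Sat ρ (∃ᶠ φ)      = ∃-transport bijection (λ b → iso-Sat (b ∷ ρ) φ)
  iso-Sat ρ (∀ᶠ φ)      = ∀-transport bijection (λ b → iso-Sat (b ∷ ρ) φ)

module Substitution {L : Language} where
  mutual
    renameT : ∀ {n m} → (Fin n → Fin m) → Term L n → Term L m
    renameT r (var i)    = var (r i)
    renameT r (app f ts) = app f (renameTs r ts)

    renameTs : ∀ {n m k} → (Fin n → Fin m) → Vec (Term L n) k → Vec (Term L m) k
    renameTs r []       = []
    renameTs r (t ∷ ts) = renameT r t ∷ renameTs r ts

  lift : ∀ {n m} → (Fin n → Term L m) → Fin (suc n) → Term L (suc m)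
  lift σ zero    = var zero
  lift σ (suc i) = renameT suc (σ i)

  mutual
    substT : ∀ {n m} → (Fin n → Term L m) → Term L n → Term L m
    substT σ (var i)    = σ i
    substT σ (app f ts) = app f (substTs σ ts)

    substTs : ∀ {n m k} → (Fin n → Term L m) → Vec (Term L n) k → Vec (Term L m) k
    substTs σ []       = []
    substTs σ (t ∷ ts) = substT σ t ∷ substTs σ ts

  subst-formula : ∀ {n m} → (Fin n → Term L m) → Formula L n → Formula L m
  subst-formula σ ⊤ᶠ          = ⊤ᶠ
  subst-formula σ ⊥ᶠ          = ⊥ᶠ
  subst-formula σ (s ≐ t)     = substT σ s ≐ substT σ t
  subst-formula σ (relᶠ R ts) = relᶠ R (substTs σ ts)
  subst-formula σ (¬ᶠ φ)      = ¬ᶠ subst-formula σ φ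
  subst-formula σ (φ ∧ᶠ ψ)    = subst-formula σ φ ∧ᶠ subst-formula σ ψ
  subst-formula σ (φ ∨ᶠ ψ)    = subst-formula σ φ ∨ᶠ subst-formula σ ψ
  subst-formula σ (φ ⇒ᶠ ψ)    = subst-formula σ φ ⇒ᶠ subst-formula σ ψ
  subst-formula σ (∃ᶠ φ)      = ∃ᶠ (subst-formula (lift σ) φ)
  subst-formula σ (∀ᶠ φ)      = ∀ᶠ (subst-formula (lift σ) φ)

  module _ {A : Set} (M : Structure L A) where
    Realizes : ∀ {n m} → Vec A m → (Fin n → Term L m) → Vec A n → Set
    Realizes ρ σ ρ' = ∀ i → evalT M ρ (σ i) ≡ lookup ρ' i

    mutual
      renameT-eval : ∀ {n m} (ρ : Vec A m) (r : Fin n → Fin m) (ρ' : Vec A n) →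
                     (∀ i → lookup ρ (r i) ≡ lookup ρ' i) →
                     ∀ t → evalT M ρ (renameT r t) ≡ evalT M ρ' t
      renameT-eval ρ r ρ' h (var i)    = h i
      renameT-eval ρ r ρ' h (app f ts) = cong (fun M f) (renameTs-eval ρ r ρ' h ts)

      renameTs-eval : ∀ {n m k} (ρ : Vec A m) (r : Fin n → Fin m) (ρ' : Vec A n) →
                      (∀ i → lookup ρ (r i) ≡ lookup ρ' i) →
                      (ts : Vec (Term L n) k) → evalTs M ρ (renameTs r ts) ≡ evalTs M ρ' ts
      renameTs-eval ρ r ρ' h []       = refl
      renameTs-eval ρ r ρ' h (t ∷ ts) =
        cong₂ _∷_ (renameT-eval ρ r ρ' h t) (renameTs-eval ρ r ρ' h ts)

    mutual
      substT-eval : ∀ {n m} (ρ : Vec A m) (σ : Fin n → Term L m) (ρ' : Vec A n) →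
                    Realizes ρ σ ρ' → ∀ t → evalT M ρ (substT σ t) ≡ evalT M ρ' t
      substT-eval ρ σ ρ' h (var i)    = h i
      substT-eval ρ σ ρ' h (app f ts) = cong (fun M f) (substTs-eval ρ σ ρ' h ts)

      substTs-eval : ∀ {n m k} (ρ : Vec A m) (σ : Fin n → Term L m) (ρ' : Vec A n) →
                     Realizes ρ σ ρ' →
                     (ts : Vec (Term L n) k) → evalTs M ρ (substTs σ ts) ≡ evalTs M ρ' ts
      substTs-eval ρ σ ρ' h []       = refl
      substTs-eval ρ σ ρ' h (t ∷ ts) =
        cong₂ _∷_ (substT-eval ρ σ ρ' h t) (substTs-eval ρ σ ρ' h ts)

    lift-realizes : ∀ {n m} (ρ : Vec A m) (σ : Fin n → Term L m) (ρ' : Vec A n) →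
                    Realizes ρ σ ρ' → ∀ a → Realizes (a ∷ ρ) (lift σ) (a ∷ ρ')
    lift-realizes ρ σ ρ' h a zero    = refl
    lift-realizes ρ σ ρ' h a (suc i) =
      trans (renameT-eval (a ∷ ρ) suc ρ (λ _ → refl) (σ i)) (h i)

    subst-Sat : ∀ {n m} (ρ : Vec A m) (σ : Fin n → Term L m) (ρ' : Vec A n) →
                Realizes ρ σ ρ' → ∀ φ → Sat M ρ (subst-formula σ φ) ⇔ Sat M ρ' φ
    subst-Sat ρ σ ρ' h ⊤ᶠ          = ⇔.refl
    subst-Sat ρ σ ρ' h ⊥ᶠ          = ⇔.refl
    subst-Sat ρ σ ρ' h (s ≐ t)     = mk⇔
      (λ eq → trans (sym (substT-eval ρ σ ρ' h s)) (trans eq (substT-eval ρ σ ρ' h t)))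
      (λ eq → trans (substT-eval ρ σ ρ' h s) (trans eq (sym (substT-eval ρ σ ρ' h t))))
    subst-Sat ρ σ ρ' h (relᶠ R ts) = mk⇔ (subst (rel M R) (substTs-eval ρ σ ρ' h ts))
                                         (subst (rel M R) (sym (substTs-eval ρ σ ρ' h ts)))
    subst-Sat ρ σ ρ' h (¬ᶠ φ)      = ¬-cong-⇔ (subst-Sat ρ σ ρ' h φ)
    subst-Sat ρ σ ρ' h (φ ∧ᶠ ψ)    = subst-Sat ρ σ ρ' h φ ×-⇔ subst-Sat ρ σ ρ' h ψ
    subst-Sat ρ σ ρ' h (φ ∨ᶠ ψ)    = subst-Sat ρ σ ρ' h φ ⊎-⇔ subst-Sat ρ σ ρ' h ψ
    subst-Sat ρ σ ρ' h (φ ⇒ᶠ ψ)    = →-cong-⇔ (subst-Sat ρ σ ρ' h φ) (subst-Sat ρ σ ρ' h ψ)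
    subst-Sat ρ σ ρ' h (∃ᶠ φ)      = ∃-transport ↔-refl λ a →
      subst-Sat (a ∷ ρ) (lift σ) (a ∷ ρ') (lift-realizes ρ σ ρ' h a) φ
    subst-Sat ρ σ ρ' h (∀ᶠ φ)      = ∀-transport ↔-refl λ a →
      subst-Sat (a ∷ ρ) (lift σ) (a ∷ ρ') (lift-realizes ρ σ ρ' h a) φ

module Demorleyize {L : Language} where
  open Substitution

  mutual
    demorleyT : ∀ {n} → Term (MorleyLang L) n → Term L n
    demorleyT (var i)    = var i
    demorleyT (app f ts) = app f (demorleyTs ts)

    demorleyTs : ∀ {n k} → Vec (Term (MorleyLang L) n) k → Vec (Term L n) k
    demorleyTs []       = []
    demorleyTs (t ∷ ts) = demorleyT t ∷ demorleyTs ts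

  demorley : ∀ {n} → Formula (MorleyLang L) n → Formula L n
  demorley ⊤ᶠ                     = ⊤ᶠ
  demorley ⊥ᶠ                     = ⊥ᶠ
  demorley (s ≐ t)                = demorleyT s ≐ demorleyT t
  demorley (relᶠ (inj₁ R) ts)     = relᶠ R (demorleyTs ts)
  demorley (relᶠ (inj₂ (_ , φ)) ts) = subst-formula (lookup (demorleyTs ts)) φ
  demorley (¬ᶠ φ)                 = ¬ᶠ demorley φ
  demorley (φ ∧ᶠ ψ)               = demorley φ ∧ᶠ demorley ψ
  demorley (φ ∨ᶠ ψ)               = demorley φ ∨ᶠ demorley ψ
  demorley (φ ⇒ᶠ ψ)               = demorley φ ⇒ᶠ demorley ψ
  demorley (∃ᶠ φ)                 = ∃ᶠ (demorley φ)
  demorley (∀ᶠ φ)                 = ∀ᶠ (demorley φ)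

  module _ {A : Set} (M : Structure L A) where
    mutual
      demorleyT-eval : ∀ {n} (ρ : Vec A n) t → evalT M ρ (demorleyT t) ≡ evalT (Morleyize M) ρ t
      demorleyT-eval ρ (var i)    = refl
      demorleyT-eval ρ (app f ts) = cong (fun M f) (demorleyTs-eval ρ ts)

      demorleyTs-eval : ∀ {n k} (ρ : Vec A n) (ts : Vec (Term (MorleyLang L) n) k) →
                        evalTs M ρ (demorleyTs ts) ≡ evalTs (Morleyize M) ρ ts
      demorleyTs-eval ρ []       = refl
      demorleyTs-eval ρ (t ∷ ts) = cong₂ _∷_ (demorleyT-eval ρ t) (demorleyTs-eval ρ ts)

    arguments-realize : ∀ {n k} (ρ : Vec A n) (ts : Vec (Term (MorleyLang L) n) k) →
                        Realizes M ρ (lookup (demorleyTs ts)) (evalTs (Morleyize M) ρ ts)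
    arguments-realize ρ (t ∷ ts) zero    = demorleyT-eval ρ t
    arguments-realize ρ (t ∷ ts) (suc i) = arguments-realize ρ ts i

    demorley-Sat : ∀ {n} (ρ : Vec A n) ψ → Sat (Morleyize M) ρ ψ ⇔ Sat M ρ (demorley ψ)
    demorley-Sat ρ ⊤ᶠ                     = ⇔.refl
    demorley-Sat ρ ⊥ᶠ                     = ⇔.refl
    demorley-Sat ρ (s ≐ t)                = mk⇔
      (λ eq → trans (demorleyT-eval ρ s) (trans eq (sym (demorleyT-eval ρ t))))
      (λ eq → trans (sym (demorleyT-eval ρ s)) (trans eq (demorleyT-eval ρ t)))
    demorley-Sat ρ (relᶠ (inj₁ R) ts)     = mk⇔ (subst (rel M R) (sym (demorleyTs-eval ρ ts)))
                                                (subst (rel M R) (demorleyTs-eval ρ ts))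
    demorley-Sat ρ (relᶠ (inj₂ (_ , φ)) ts) =
      ⇔.sym (subst-Sat M ρ (lookup (demorleyTs ts)) _ (arguments-realize ρ ts) φ)
    demorley-Sat ρ (¬ᶠ φ)                 = ¬-cong-⇔ (demorley-Sat ρ φ)
    demorley-Sat ρ (φ ∧ᶠ ψ)               = demorley-Sat ρ φ ×-⇔ demorley-Sat ρ ψ
    demorley-Sat ρ (φ ∨ᶠ ψ)               = demorley-Sat ρ φ ⊎-⇔ demorley-Sat ρ ψ
    demorley-Sat ρ (φ ⇒ᶠ ψ)               = →-cong-⇔ (demorley-Sat ρ φ) (demorley-Sat ρ ψ)
    demorley-Sat ρ (∃ᶠ φ)                 = ∃-transport ↔-refl λ a → demorley-Sat (a ∷ ρ) φ
    demorley-Sat ρ (∀ᶠ φ)                 = ∀-transport ↔-refl λ a → demorley-Sat (a ∷ ρ) φ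

    morleyization-is-reduct : IsReduct M (Morleyize M)
    morleyization-is-reduct n R (ψ , R⇔ψ) = demorley ψ , λ ā → ⇔.trans (R⇔ψ ā) (demorley-Sat ā ψ)

module AtomicDefinitions {L : Language} {A : Set} (N : Structure L A) where
  variables-eval : ∀ {n k} (ρ : Vec A n) (g : Fin k → Fin n) →
                   evalTs N ρ (tabulate (λ i → var (g i))) ≡ tabulate (λ i → lookup ρ (g i))
  variables-eval {k = zero}  ρ g = refl
  variables-eval {k = suc k} ρ g = cong (lookup ρ (g zero) ∷_) (variables-eval ρ (λ i → g (suc i)))

  graphᶠ : (f : Func L) → Formula L (suc (funArity L f))
  graphᶠ f = app f (tabulate (λ i → var (suc i))) ≐ var zero

  graph-Sat : ∀ f (y : A) xs → Sat N (y ∷ xs) (graphᶠ f) ⇔ (fun N f xs ≡ y)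
  graph-Sat f y xs = mk⇔ (trans (cong (fun N f) (sym args))) (trans (cong (fun N f) args))
    where args = trans (variables-eval (y ∷ xs) suc) (tabulate∘lookup xs)

  relationᶠ : (R : Rel L) → Formula L (relArity L R)
  relationᶠ R = relᶠ R (tabulate var)

  relation-Sat : ∀ R xs → Sat N xs (relationᶠ R) ⇔ rel N R xs
  relation-Sat R xs = mk⇔ (subst (rel N R) args) (subst (rel N R) (sym args))
    where args = trans (variables-eval xs (λ i → i)) (tabulate∘lookup xs)

-- An elementary copy of M: a subset InCopy of A with a bijection
-- to : InCopy → A  which preserves and reflects every formula (equivalently,
-- an elementary embedding of M into itself with image InCopy).
record ElementaryCopy {L : Language} {A : Set} (M : Structure L A) : Set₁ where
  field
    InCopy      : A → Set
    InCopy-prop : ∀ x (p q : InCopy x) → p ≡ q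
    to          : Σ A InCopy → A
    from        : A → Σ A InCopy
    from-to     : ∀ x → from (to x) ≡ x
    to-from     : ∀ y → to (from y) ≡ y
    agrees      : ∀ n (φ : Formula L n) (ρ : Vec (Σ A InCopy) n) →
                  Sat M (map proj₁ ρ) φ ⇔ Sat M (map to ρ) φ

module _ {L : Language} {A : Set} (M : Structure L A) where
  CopyIndivisible : Set₁
  CopyIndivisible = (c : A → Bool) →
    Σ (ElementaryCopy M) λ E → Σ Bool λ b → ∀ x → ElementaryCopy.InCopy E x → c x ≡ b

  elementarySub⇒copy : (S : Substructure M) → Iso (induced M S) M → ElementarySub M S →
                       ElementaryCopy M
  elementarySub⇒copy S I elem = record
    { InCopy = P S ; InCopy-prop = P-prop S ; to = to ; from = from ; from-to = from-to ; to-from = to-from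
    ; agrees = λ n φ ρ → ⇔.trans (⇔.sym (elem n φ ρ)) (IsoSat.iso-Sat I ρ φ) }
    where open Iso I

  -- A substructure of M̂ isomorphic to M̂ is an elementary copy of M: the
  -- isomorphism preserves each Morley relation R_φ, i.e. each formula φ.
  morleyIso⇒copy : (S : Substructure (Morleyize M)) → Iso (induced (Morleyize M) S) (Morleyize M) →
                   ElementaryCopy M
  morleyIso⇒copy S I = record
    { InCopy = P S ; InCopy-prop = P-prop S ; to = to ; from = from ; from-to = from-to ; to-from = to-from
    ; agrees = λ n φ → to-rel (inj₂ (n , φ)) }
    where open Iso I

  elemIndivisible⇒copyIndivisible : ElemIndivisible M → CopyIndivisible
  elemIndivisible⇒copyIndivisible ind c with ind c
  ... | S , mono , I , elem = elementarySub⇒copy S I elem , mono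

  morleyIndivisible⇒copyIndivisible : Indivisible (Morleyize M) → CopyIndivisible
  morleyIndivisible⇒copyIndivisible ind c with ind c
  ... | S , mono , I = morleyIso⇒copy S I , mono

-- An elementary copy of M is an elementary copy of every reduct N of M: each
-- N-formula is equivalent to an M-formula, which the copy respects.
copy-of-reduct : {L L' : Language} {A : Set} {M : Structure L A} {N : Structure L' A} →
                 IsReduct M N → ElementaryCopy M → ElementaryCopy N
copy-of-reduct {N = N} reduct E = record
  { InCopy = InCopy ; InCopy-prop = InCopy-prop ; to = to ; from = from ; from-to = from-to ; to-from = to-from
  ; agrees = agrees-N }
  where
    open ElementaryCopy E
    agrees-N : ∀ n ψ (ρ : Vec (Σ _ InCopy) n) → Sat N (map proj₁ ρ) ψ ⇔ Sat N (map to ρ) ψ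
    agrees-N n ψ ρ with reduct n (λ ā → Sat N ā ψ) (ψ , λ _ → ⇔.refl)
    ... | φ , ψ⇔φ = ⇔.trans (ψ⇔φ (map proj₁ ρ)) (⇔.trans (agrees n φ ρ) (⇔.sym (ψ⇔φ (map to ρ))))

module Realize {L : Language} {A : Set} {N : Structure L A} (E : ElementaryCopy N) where
  open ElementaryCopy E
  open AtomicDefinitions N

  -- Closure: f(x̄) is the first coordinate of  from (f(to x̄)), as the graph of
  -- f holds at  to (from (f(to x̄))), to x̄  and hence at the original tuple.
  closed-under-functions : ∀ f (xs : Vec (Σ A InCopy) (funArity L f)) → InCopy (fun N f (map proj₁ xs))
  closed-under-functions f xs = subst InCopy (sym value) (proj₂ preimage)
    where
      preimage = from (fun N f (map to xs))
      value : fun N f (map proj₁ xs) ≡ proj₁ preimage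
      value = forward (graph-Sat f _ _)
                (backward (agrees _ (graphᶠ f) (preimage ∷ xs))
                  (backward (graph-Sat f _ _) (sym (to-from _))))

  substructure : Substructure N
  substructure = record { P = InCopy ; P-prop = InCopy-prop ; closed = closed-under-functions }

  iso : Iso (induced N substructure) N
  iso = record
    { to = to ; from = from ; from-to = from-to ; to-from = to-from
    ; to-fun = λ f xs → sym (forward (graph-Sat f _ _)
                 (forward (agrees _ (graphᶠ f) ((fun N f (map proj₁ xs) , closed-under-functions f xs) ∷ xs))
                   (backward (graph-Sat f _ _) refl)))
    ; to-rel = λ R xs → ⇔.trans (⇔.sym (relation-Sat R (map proj₁ xs)))
                          (⇔.trans (agrees _ (relationᶠ R) xs) (relation-Sat R (map to xs))) }

  elementary : ElementarySub N substructure
  elementary n φ ρ = ⇔.trans (IsoSat.iso-Sat iso ρ φ) (⇔.sym (agrees n φ ρ))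

copyIndivisible⇒reducts : {L : Language} {A : Set} {M : Structure L A} → CopyIndivisible M →
  (L' : Language) (N : Structure L' A) → IsReduct M N → ElemIndivisible N
copyIndivisible⇒reducts ind L' N reduct c with ind c
... | E , mono = substructure , mono , iso , elementary
  where open Realize (copy-of-reduct reduct E)

elemIndivisible⇒indivisible : {L : Language} {A : Set} {N : Structure L A} →
                              ElemIndivisible N → Indivisible N
elemIndivisible⇒indivisible ind c with ind c
... | S , mono , I , _ = S , mono , I

lemma2p18 : {L : Language} {A : Set} (M : Structure L A) →
    (ElemIndivisible M ⇔ Indivisible (Morleyize M))
    × (ElemIndivisible M ⇔ ElemIndivisible (Morleyize M))
    × (ElemIndivisible M ⇔ ((L' : Language) (N : Structure L' A) → IsReduct M N → Indivisible N))
    × (ElemIndivisible M ⇔ ((L' : Language) (N : Structure L' A) → IsReduct M N → ElemIndivisible N))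
lemma2p18 {L} {A} M =
    mk⇔ (3⇒2 ∘ 1⇒3) 2⇒1
  , mk⇔ 1⇒3 (2⇒1 ∘ 3⇒2)
  , mk⇔ (5⇒4 ∘ 1⇒5) (2⇒1 ∘ 4⇒2)
  , mk⇔ 1⇒5 (2⇒1 ∘ 4⇒2 ∘ 5⇒4)
  where
    M̂ : Structure (MorleyLang L) A
    M̂ = Morleyize M

    AllReducts : ({L' : Language} → Structure L' A → Set₁) → Set₁
    AllReducts Q = (L' : Language) (N : Structure L' A) → IsReduct M N → Q N

    1⇒5 : ElemIndivisible M → AllReducts ElemIndivisible
    1⇒5 = copyIndivisible⇒reducts ∘ elemIndivisible⇒copyIndivisible M

    5⇒4 : AllReducts ElemIndivisible → AllReducts Indivisible
    5⇒4 ind L' N reduct = elemIndivisible⇒indivisible (ind L' N reduct)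

    4⇒2 : AllReducts Indivisible → Indivisible M̂
    4⇒2 ind = ind (MorleyLang L) M̂ (Demorleyize.morleyization-is-reduct M)

    2⇒1 : Indivisible M̂ → ElemIndivisible M
    2⇒1 ind = copyIndivisible⇒reducts (morleyIndivisible⇒copyIndivisible M ind) L M reduct-of-itself
      where
        reduct-of-itself : IsReduct M M
        reduct-of-itself _ _ definable = definable

    1⇒3 : ElemIndivisible M → ElemIndivisible M̂
    1⇒3 ind = 1⇒5 ind (MorleyLang L) M̂ (Demorleyize.morleyization-is-reduct M)

    3⇒2 : ElemIndivisible M̂ → Indivisible M̂
    3⇒2 = elemIndivisible⇒indivisible
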